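{- Let $L$ be a finite sequence of colored items all of which have size zero. Then $L$ can be packed validly, without reordering, into $\mathrm{LB}_2(L)$ bins, where, writing the items as $1,\dots,n$ and setting $s_{c,\ell}=1$ if item $\ell$ has color $c$ and $s_{c,\ell}=-1$ otherwise, $\mathrm{LB}_2(L) = \max_{c \in C}\max_{1\le i\le j\le n}\sum_{\ell=i}^{j} s_{c,\ell}$.
   Context: Colored Bin Packing: items arrive as a sequence; each item has a size in $[0,1]$ and a color from a finite set $C$. A packing assigns every item to a bin of unit capacity; the items in a bin are ordered by their position in the input sequence (no reordering). A packing is valid if in every bin the total size is at most $1$ and no two items that are consecutive in that bin (in this order) have the same color. -}

module Defs where

open import Data.Nat using (ℕ; zero; suc; _∸_)
open import Data.Fin using (Fin; _<_; _≟_)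
open import Data.List using (List; []; _∷_; length; lookup; map; sum; take; drop; allFin; upTo; foldr; concatMap)
open import Data.Integer as ℤ using (ℤ; _⊔_; ∣_∣) renaming (_+_ to _+ℤ_)
open import Data.Rational as ℚ using (ℚ; 0ℚ; 1ℚ) renaming (_+_ to _+ℚ_; _≤_ to _≤ℚ_)
open import Data.Bool using (if_then_else_)
open import Relation.Nullary using (¬_)
open import Relation.Nullary.Decidable using (⌊_⌋)
open import Relation.Binary.PropositionalEquality using (_≡_; _≢_)
open import Data.Product using (_×_)

-- An item: a size (a rational; the paper's sizes lie in [0,1]) and a color from C = Fin k.
record Item (k : ℕ) : Set where
  constructor item
  field
    size  : ℚ
    color : Fin k
open Item public

sval : ∀ {k} → Fin k → Item k → ℤ
sval c x = if ⌊ color x ≟ c ⌋ then ℤ.1ℤ else ℤ.-1ℤ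

-- Sum of s_{c,ℓ} over the 0-based segment ℓ = i, …, i + d.
segSum : ∀ {k} → Fin k → List (Item k) → ℕ → ℕ → ℤ
segSum c L i d = foldr _+ℤ_ ℤ.0ℤ (take (suc d) (drop i (map (sval c) L)))

-- max over c ∈ C and 0 ≤ i ≤ j < n of the segment sums (j = i + d), folded
-- with ⊔ starting from 0 (so the empty sequence gets 0; for nonempty L the
-- true maximum is ≥ 1, so the 0 seed does not change it).
LB2ℤ : ∀ {k} → List (Item k) → ℤ
LB2ℤ {k} L =
  foldr _⊔_ ℤ.0ℤ
    (concatMap (λ c →
      concatMap (λ i →
        map (λ d → segSum c L i d) (upTo (length L ∸ i)))
      (upTo (length L)))
    (allFin k))

-- LB₂(L) as a natural number (LB2ℤ L ≥ 0 always).
LB2 : ∀ {k} → List (Item k) → ℕ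
LB2 L = ∣ LB2ℤ L ∣

Packing : ∀ {k} → List (Item k) → ℕ → Set
Packing L m = Fin (length L) → Fin m

load : ∀ {k m} (L : List (Item k)) → Packing L m → Fin m → ℚ
load L f b =
  foldr _+ℚ_ 0ℚ
    (map (λ i → if ⌊ f i ≟ b ⌋ then size (lookup L i) else 0ℚ) (allFin (length L)))

ConsecutiveIn : ∀ {k m} (L : List (Item k)) → Packing L m → Fin m →
                Fin (length L) → Fin (length L) → Set
ConsecutiveIn L f b i j =
  i < j × f i ≡ b × f j ≡ b × (∀ l → i < l → l < j → f l ≢ b)

Valid : ∀ {k m} (L : List (Item k)) → Packing L m → Set
Valid {m = m} L f =
  ∀ (b : Fin m) →
    (load L f b ≤ℚ 1ℚ) ×
    (∀ i j → ConsecutiveIn L f b i j → color (lookup L i) ≢ color (lookup L j))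

module Submission where

-- For a colour d and a list R, the excess of d on R is the largest sum of
-- s_d over a prefix of R (or 0).  Every excess on a suffix of L is a segment
-- sum of L, hence at most m = LB₂(L); it follows by induction that two
-- different colours have joint excess at most m on every suffix.
--
-- The packing is built greedily, item by item, remembering only which
-- colour ends each bin.  The invariant Room says that for every colour d the
-- bins ending in d plus the excess of d on the remaining items fit into m.
-- An item x of colour c goes to a bin not ending in c; this keeps Room for
-- c.  For another colour d, passing x raises the remaining excess of d by at
-- most one, so Room can fail for d only by one ("d is in danger"), and is
-- restored if x goes to a bin ending in d.  Two colours together end at most m
-- bins, so by the joint-excess bound at most one colour is in danger, and a
-- single bin serves both purposes (choose-bin).  A run that never appends an
-- item to a bin ending in its own colour is a valid packing (safeRun-valid);
-- with zero sizes the capacity constraint holds trivially.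

open import Defs
open import Data.Nat using (ℕ)
open import Data.List using (List)
open import Data.List.Relation.Unary.All using (All)
open import Data.Rational using (0ℚ)
open import Data.Product using (Σ)
open import Relation.Binary.PropositionalEquality using (_≡_)

open import Data.Bool using (if_then_else_)
open import Data.Empty using (⊥-elim)
open import Data.Fin as Fin using (Fin; zero; suc; _≟_)
open import Data.Fin.Properties using (any?)
open import Data.Integer as ℤ using (ℤ; +≤+; _⊔_; ∣_∣)
import Data.Integer.Properties as ℤ
open import Data.List using ([]; _∷_; length; lookup; map; take; drop; foldr)
open import Data.List.Properties using (drop-map; length-drop)
open import Data.List.Membership.Propositional using (_∈_; lose)
open import Data.List.Membership.Propositional.Properties
  using (∈-concatMap⁺; ∈-map⁺; ∈-upTo⁺; ∈-allFin; ∈-lookup)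
open import Data.List.Relation.Unary.All as All using ([]; _∷_)
open import Data.List.Relation.Unary.All.Properties using (map⁺; tabulate⁺)
open import Data.List.Relation.Unary.Any using (here; there)
open import Data.Maybe using (Maybe; just; nothing)
open import Data.Maybe.Properties using (just-injective) renaming (≡-dec to ≡-dec-Maybe)
open import Data.Nat using (zero; suc; pred; _+_; _∸_; _≤_; _<_; _<?_; z≤n; s≤s; z<s; s<s; s<s⁻¹)
open import Data.Nat.Properties
  using (≤-trans; ≤-reflexive; <-≤-trans; <⇒≱; ≮⇒≥; +-suc; +-comm; +-identityʳ; +-assoc;
         +-mono-≤; +-monoˡ-≤; +-mono-<; m<m+n; m≤m+n; n≤1+n; pred[n]≤n; m∸n≢0⇒n<m; m<n⇒n≢0;
         +-commutativeSemigroup; module ≤-Reasoning)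
open import Algebra.Properties.CommutativeSemigroup +-commutativeSemigroup using (interchange)
open import Data.Product using (_,_; _×_)
open import Data.Rational as ℚ using (1ℚ)
import Data.Rational.Properties as ℚ
open import Data.Vec.Functional using (Vector; head; tail; updateAt)
open import Data.Vec.Functional.Properties using (updateAt-updates; updateAt-minimal)
open import Function using (const)
open import Relation.Nullary using (Dec; does; yes; no; ¬?)
open import Relation.Nullary.Decidable using (⌊_⌋; dec-true; dec-false; _×-dec_)
open import Relation.Binary.PropositionalEquality
  using (_≢_; refl; sym; trans; cong; subst; module ≡-Reasoning)

module _ {k : ℕ} where

  -- excess d R = max (0, largest sum of s_d over a prefix of R): by how much
  -- colour d can outnumber the other colours in an initial segment of R.
  excess : Fin k → List (Item k) → ℕ
  excess d []      = 0
  excess d (x ∷ R) = if does (color x ≟ d) then suc (excess d R) else pred (excess d R)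

  excess-same : ∀ {d} x R → color x ≡ d → excess d (x ∷ R) ≡ suc (excess d R)
  excess-same x R refl rewrite dec-true (color x ≟ color x) refl = refl

  excess-other : ∀ {d} x R → color x ≢ d → excess d (x ∷ R) ≡ pred (excess d R)
  excess-other {d} x R c≢d rewrite dec-false (color x ≟ d) c≢d = refl

  SuffixBounded : ℕ → List (Item k) → Set
  SuffixBounded m R = ∀ i d → excess d (drop i R) ≤ m

  prefixSum : Fin k → List (Item k) → ℕ → ℤ
  prefixSum d R e = foldr ℤ._+_ ℤ.0ℤ (take (suc e) (map (sval d) R))

  -- A positive excess is the sum over some nonempty prefix.  (Coverage:
  -- the omitted cases are those where eq equates 0 with a successor.)
  excess-attained : ∀ d R v → excess d R ≡ suc v →
                    Σ ℕ λ e → e < length R × prefixSum d R e ≡ ℤ.+ suc v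
  excess-attained d (x ∷ R) v eq with color x ≟ d | excess d R in eqR
  ... | yes _ | zero = 0 , z<s , cong ℤ.+_ eq
  ... | yes _ | suc w with refl ← eq with e , e<R , sum≡ ← excess-attained d R w eqR =
    suc e , s≤s e<R , cong (λ z → ℤ.1ℤ ℤ.+ z) sum≡
  ... | no _ | suc (suc w) with refl ← eq with e , e<R , sum≡ ← excess-attained d R (suc w) eqR =
    suc e , s≤s e<R , cong (λ z → ℤ.-1ℤ ℤ.+ z) sum≡

  ⊔-fold-upper : ∀ {z} (zs : List ℤ) → z ∈ zs → z ℤ.≤ foldr _⊔_ ℤ.0ℤ zs
  ⊔-fold-upper (z ∷ zs) (here refl) = ℤ.i≤i⊔j z _
  ⊔-fold-upper (z ∷ zs) (there z∈zs) = ℤ.≤-trans (⊔-fold-upper zs z∈zs) (ℤ.i≤j⊔i z _)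

  segSum≤LB2ℤ : ∀ c (L : List (Item k)) {i e} → i < length L → e < length L ∸ i →
                segSum c L i e ℤ.≤ LB2ℤ L
  segSum≤LB2ℤ c L {i} {e} i<n e<n∸i = ⊔-fold-upper _
    (∈-concatMap⁺ _ (lose (∈-allFin c)
      (∈-concatMap⁺ _ (lose (∈-upTo⁺ i<n) (∈-map⁺ (segSum c L i) (∈-upTo⁺ e<n∸i))))))

  +≤⇒≤∣∣ : ∀ {n z} → ℤ.+ n ℤ.≤ z → n ≤ ∣ z ∣
  +≤⇒≤∣∣ (+≤+ n≤m) = n≤m

  excess≤LB2 : ∀ (L : List (Item k)) → SuffixBounded (LB2 L) L
  excess≤LB2 L i d with excess d (drop i L) in eq
  ... | zero = z≤n
  ... | suc v with e , e<len , sum≡ ← excess-attained d (drop i L) v eq =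
    +≤⇒≤∣∣ (ℤ.≤-trans (ℤ.≤-reflexive (sym segment≡)) (segSum≤LB2ℤ d L i<n e<n∸i))
    where
    e<n∸i : e < length L ∸ i
    e<n∸i = ≤-trans e<len (≤-reflexive (length-drop i L))
    i<n : i < length L
    i<n = m∸n≢0⇒n<m (m<n⇒n≢0 e<n∸i)
    segment≡ : segSum d L i e ≡ ℤ.+ suc v
    segment≡ = trans (cong (λ ys → foldr ℤ._+_ ℤ.0ℤ (take (suc e) ys)) (drop-map i L)) sum≡

  rise-and-fall : ∀ {a b m} → suc a ≤ m → a + b ≤ m → suc a + pred b ≤ m
  rise-and-fall {a} {zero}  {m} a<m _     = subst (_≤ m) (sym (+-identityʳ (suc a))) a<m
  rise-and-fall {a} {suc b} {m} _   a+b≤m = subst (_≤ m) (+-suc a b) a+b≤m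

  excess-pair : ∀ {m} R {d₁ d₂} → d₁ ≢ d₂ → SuffixBounded m R → excess d₁ R + excess d₂ R ≤ m
  excess-pair [] _ _ = z≤n
  excess-pair {m} (x ∷ R) {d₁} {d₂} d₁≢d₂ bounded
    with excess-pair R d₁≢d₂ (λ i → bounded (suc i)) | color x ≟ d₁ | color x ≟ d₂
  ... | _    | yes refl | yes refl = ⊥-elim (d₁≢d₂ refl)
  ... | rest | yes c≡d₁ | no _     =
    rise-and-fall (subst (_≤ m) (excess-same x R c≡d₁) (bounded 0 d₁)) rest
  ... | rest | no _     | yes c≡d₂ = subst (_≤ m) (+-comm (suc (excess d₂ R)) _)
    (rise-and-fall (subst (_≤ m) (excess-same x R c≡d₂) (bounded 0 d₂))
                   (subst (_≤ m) (+-comm (excess d₁ R) _) rest))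
  ... | rest | no _     | no _     = ≤-trans (+-mono-≤ (pred[n]≤n {excess d₁ R}) (pred[n]≤n {excess d₂ R})) rest

  _≟ₘ_ : (o o′ : Maybe (Fin k)) → Dec (o ≡ o′)
  _≟ₘ_ = ≡-dec-Maybe _≟_

  -- The state of a partial packing into m bins: the colour of the last item
  -- of every bin (nothing while the bin is empty).
  BinEnds : ℕ → Set
  BinEnds m = Vector (Maybe (Fin k)) m

  put : ∀ {m} → BinEnds m → Fin m → Fin k → BinEnds m
  put s b c = updateAt s b (const (just c))

  endsIn : Maybe (Fin k) → Fin k → ℕ
  endsIn nothing  d = 0
  endsIn (just c) d = if does (c ≟ d) then 1 else 0

  endsIn-same : ∀ c → endsIn (just c) c ≡ 1
  endsIn-same c rewrite dec-true (c ≟ c) refl = refl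

  endsIn-other : ∀ {o d} → o ≢ just d → endsIn o d ≡ 0
  endsIn-other {nothing} _ = refl
  endsIn-other {just c} {d} c≢d rewrite dec-false (c ≟ d) (λ c≡d → c≢d (cong just c≡d)) = refl

  endsIn-pair : ∀ o {d₁ d₂} → d₁ ≢ d₂ → endsIn o d₁ + endsIn o d₂ ≤ 1
  endsIn-pair nothing _ = z≤n
  endsIn-pair (just c) {d₁} {d₂} d₁≢d₂ with c ≟ d₁ | c ≟ d₂
  ... | yes refl | yes refl = ⊥-elim (d₁≢d₂ refl)
  ... | yes _    | no _     = s≤s z≤n
  ... | no _     | yes _    = s≤s z≤n
  ... | no _     | no _     = z≤n

  ending : ∀ {m} → BinEnds m → Fin k → ℕ
  ending {zero}  s d = 0
  ending {suc m} s d = endsIn (head s) d + ending (tail s) d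

  ending-empty : ∀ m d → ending {m} (const nothing) d ≡ 0
  ending-empty zero    d = refl
  ending-empty (suc m) d = ending-empty m d

  -- A bin ends in at most one colour, so two colours together end at most m bins.
  ending-pair : ∀ {m} (s : BinEnds m) {d₁ d₂} → d₁ ≢ d₂ → ending s d₁ + ending s d₂ ≤ m
  ending-pair {zero}  s _ = z≤n
  ending-pair {suc m} s {d₁} {d₂} d₁≢d₂ =
    subst (_≤ suc m) (interchange (endsIn (head s) d₁) (endsIn (head s) d₂) _ _)
      (+-mono-≤ (endsIn-pair (head s) d₁≢d₂) (ending-pair (tail s) d₁≢d₂))

  ending-update : ∀ {m} (s : BinEnds m) b a d →
                  ending (updateAt s b (const a)) d + endsIn (s b) d ≡ ending s d + endsIn a d
  ending-update {suc m} s zero a d = begin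
    (endsIn a d + ending (tail s) d) + endsIn (head s) d ≡⟨ +-comm (endsIn a d + _) _ ⟩
    endsIn (head s) d + (endsIn a d + ending (tail s) d) ≡⟨ cong (endsIn (head s) d +_) (+-comm (endsIn a d) _) ⟩
    endsIn (head s) d + (ending (tail s) d + endsIn a d) ≡⟨ sym (+-assoc (endsIn (head s) d) _ _) ⟩
    (endsIn (head s) d + ending (tail s) d) + endsIn a d ∎
    where open ≡-Reasoning
  ending-update {suc m} s (suc b) a d = begin
    (endsIn (head s) d + ending (updateAt (tail s) b (const a)) d) + endsIn (s (suc b)) d
      ≡⟨ +-assoc (endsIn (head s) d) _ _ ⟩
    endsIn (head s) d + (ending (updateAt (tail s) b (const a)) d + endsIn (tail s b) d)
      ≡⟨ cong (endsIn (head s) d +_) (ending-update (tail s) b a d) ⟩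
    endsIn (head s) d + (ending (tail s) d + endsIn a d)
      ≡⟨ sym (+-assoc (endsIn (head s) d) _ _) ⟩
    (endsIn (head s) d + ending (tail s) d) + endsIn a d ∎
    where open ≡-Reasoning

  bin-ending-in : ∀ {m} (s : BinEnds m) d → 0 < ending s d → Σ (Fin m) λ b → s b ≡ just d
  bin-ending-in {suc m} s d pos with head s ≟ₘ just d
  ... | yes s₀≡d = zero , s₀≡d
  ... | no s₀≢d with b , sb≡d ← bin-ending-in (tail s) d
                                  (subst (λ n → 0 < n + ending (tail s) d) (endsIn-other s₀≢d) pos) =
    suc b , sb≡d

  bin-not-ending-in : ∀ {m} (s : BinEnds m) c → ending s c < m → Σ (Fin m) λ b → s b ≢ just c
  bin-not-ending-in {suc m} s c lt with head s ≟ₘ just c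
  ... | no s₀≢c = zero , s₀≢c
  ... | yes s₀≡c with b , sb≢c ← bin-not-ending-in (tail s) c
         (s<s⁻¹ (subst (λ n → n + ending (tail s) c < suc m)
                       (trans (cong (λ o → endsIn o c) s₀≡c) (endsIn-same c)) lt)) =
    suc b , sb≢c

  module _ {m} (s : BinEnds m) {b : Fin m} {c : Fin k} (sb≢c : s b ≢ just c) where

    ending-put-same : ending (put s b c) c ≡ suc (ending s c)
    ending-put-same = begin
      ending (put s b c) c                    ≡⟨ sym (+-identityʳ _) ⟩
      ending (put s b c) c + 0                ≡⟨ cong (ending (put s b c) c +_) (sym (endsIn-other sb≢c)) ⟩
      ending (put s b c) c + endsIn (s b) c   ≡⟨ ending-update s b (just c) c ⟩
      ending s c + endsIn (just c) c          ≡⟨ cong (ending s c +_) (endsIn-same c) ⟩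
      ending s c + 1                          ≡⟨ +-comm (ending s c) 1 ⟩
      suc (ending s c)                        ∎
      where open ≡-Reasoning

    ending-put-other : ∀ {e} → e ≢ c → ending (put s b c) e + endsIn (s b) e ≡ ending s e
    ending-put-other {e} e≢c = begin
      ending (put s b c) e + endsIn (s b) e   ≡⟨ ending-update s b (just c) e ⟩
      ending s e + endsIn (just c) e          ≡⟨ cong (ending s e +_) (endsIn-other (λ c≡e → e≢c (sym (just-injective c≡e)))) ⟩
      ending s e + 0                          ≡⟨ +-identityʳ _ ⟩
      ending s e                              ∎
      where open ≡-Reasoning

    ending-put-≤ : ∀ {e} → e ≢ c → ending (put s b c) e ≤ ending s e
    ending-put-≤ {e} e≢c = ≤-trans (m≤m+n _ (endsIn (s b) e)) (≤-reflexive (ending-put-other e≢c))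

    ending-put-relieves : ∀ {e} → e ≢ c → s b ≡ just e → suc (ending (put s b c) e) ≡ ending s e
    ending-put-relieves {e} e≢c sb≡e = begin
      suc (ending (put s b c) e)              ≡⟨ +-comm 1 _ ⟩
      ending (put s b c) e + 1                ≡⟨ cong (ending (put s b c) e +_) (sym (trans (cong (λ o → endsIn o e) sb≡e) (endsIn-same e))) ⟩
      ending (put s b c) e + endsIn (s b) e   ≡⟨ ending-put-other e≢c ⟩
      ending s e                              ∎
      where open ≡-Reasoning

  Room : ∀ {m} → List (Item k) → BinEnds m → Set
  Room {m} R s = ∀ d → ending s d + excess d R ≤ m

  Danger : ∀ {m} → List (Item k) → BinEnds m → Fin k → Set
  Danger {m} R s d = m < ending s d + excess d R

  -- At most one colour is in danger, since two colours together end at most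
  -- m bins and have joint excess at most m.
  danger-unique : ∀ {m} R (s : BinEnds m) {d e} → SuffixBounded m R →
                  Danger R s d → Danger R s e → d ≡ e
  danger-unique {m} R s {d} {e} bounded d-danger e-danger with d ≟ e
  ... | yes d≡e = d≡e
  ... | no d≢e  = ⊥-elim (<⇒≱ (+-mono-< d-danger e-danger)
    (subst (_≤ m + m) (interchange (ending s d) (ending s e) (excess d R) (excess e R))
           (+-mono-≤ (ending-pair s d≢e) (excess-pair R d≢e bounded))))

  positive-part : ∀ a {n m} → m < a + n → n ≤ m → 0 < a
  positive-part zero    m<n n≤m = ⊥-elim (<⇒≱ m<n n≤m)
  positive-part (suc a) _   _   = z<s

  +-pred-≤ : ∀ a n → a + n ≤ suc a + pred n
  +-pred-≤ a zero    = n≤1+n (a + 0)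
  +-pred-≤ a (suc n) = ≤-reflexive (+-suc a n)

  room-after-put : ∀ {m} x R (s : BinEnds m) {b} → s b ≢ just (color x) → Room (x ∷ R) s →
                   (∀ e → e ≢ color x → Danger R s e → s b ≡ just e) →
                   Room R (put s b (color x))
  room-after-put {m} x R s {b} sb≢c room relief e with e ≟ color x
  ... | yes refl = begin
    ending (put s b e) e + excess e R  ≡⟨ cong (_+ excess e R) (ending-put-same s sb≢c) ⟩
    suc (ending s e) + excess e R      ≡⟨ sym (+-suc (ending s e) _) ⟩
    ending s e + suc (excess e R)      ≡⟨ cong (ending s e +_) (sym (excess-same x R refl)) ⟩
    ending s e + excess e (x ∷ R)      ≤⟨ room e ⟩
    m                                  ∎
    where open ≤-Reasoning
  ... | no e≢c with m <? ending s e + excess e R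
  ...   | no safe = ≤-trans (+-monoˡ-≤ _ (ending-put-≤ s sb≢c e≢c)) (≮⇒≥ safe)
  ...   | yes danger = begin
    ending (put s b (color x)) e + excess e R              ≤⟨ +-pred-≤ _ (excess e R) ⟩
    suc (ending (put s b (color x)) e) + pred (excess e R)
      ≡⟨ cong (_+ pred (excess e R)) (ending-put-relieves s sb≢c e≢c (relief e e≢c danger)) ⟩
    ending s e + pred (excess e R)    ≡⟨ cong (ending s e +_) (sym (excess-other x R (λ c≡e → e≢c (sym c≡e)))) ⟩
    ending s e + excess e (x ∷ R)     ≤⟨ room e ⟩
    m                                 ∎
    where open ≤-Reasoning

  choose-bin : ∀ {m} x R (s : BinEnds m) → SuffixBounded m (x ∷ R) → Room (x ∷ R) s →
               Σ (Fin m) λ b → s b ≢ just (color x) × (∀ e → e ≢ color x → Danger R s e → s b ≡ just e)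
  choose-bin {m} x R s bounded room
    with any? (λ d → ¬? (d ≟ color x) ×-dec (m <? ending s d + excess d R))
  ... | yes (d , d≢c , d-danger)
    with b , sb≡d ← bin-ending-in s d (positive-part (ending s d) d-danger (bounded 1 d)) =
    b , (λ sb≡c → d≢c (just-injective (trans (sym sb≡d) sb≡c))) ,
    λ e _ e-danger → subst (λ d′ → s b ≡ just d′)
                           (danger-unique R s (λ i → bounded (suc i)) d-danger e-danger) sb≡d
  ... | no no-danger
    with b , sb≢c ← bin-not-ending-in s (color x)
           (<-≤-trans (m<m+n _ z<s) (subst (λ n → ending s (color x) + n ≤ m)
                                             (excess-same x R refl) (room (color x)))) =
    b , sb≢c , λ e e≢c e-danger → ⊥-elim (no-danger (e , e≢c , e-danger))

  data SafeRun {m : ℕ} : List (Item k) → BinEnds m → Set where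
    done  : ∀ {s} → SafeRun [] s
    place : ∀ {x R s} (b : Fin m) → s b ≢ just (color x) →
            SafeRun R (put s b (color x)) → SafeRun (x ∷ R) s

  bins : ∀ {m R} {s : BinEnds m} → SafeRun R s → Fin (length R) → Fin m
  bins (place b _ _) zero    = b
  bins (place _ _ r) (suc i) = bins r i

  first-in-bin-fresh : ∀ {m R} {s : BinEnds m} (r : SafeRun R s) j b →
                       (∀ l → l Fin.< j → bins r l ≢ b) → bins r j ≡ b →
                       s b ≢ just (color (lookup R j))
  first-in-bin-fresh (place _ fresh _) zero b _ refl = fresh
  first-in-bin-fresh {s = s} (place b₀ _ r) (suc j) b earlier r-j≡b =
    subst (_≢ _) (updateAt-minimal b b₀ s (λ b≡b₀ → earlier zero z<s (sym b≡b₀)))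
      (first-in-bin-fresh r j b (λ l l<j → earlier (suc l) (s<s l<j)) r-j≡b)

  safeRun-valid : ∀ {m R} {s : BinEnds m} (r : SafeRun R s) b i j →
                  ConsecutiveIn R (bins r) b i j → color (lookup R i) ≢ color (lookup R j)
  safeRun-valid {s = s} (place b₀ _ r) b zero (suc j) (_ , refl , r-j≡b , between) cᵢ≡cⱼ =
    first-in-bin-fresh r j b₀ (λ l l<j → between (suc l) z<s (s<s l<j)) r-j≡b
      (trans (updateAt-updates b₀ s) (cong just cᵢ≡cⱼ))
  safeRun-valid (place _ _ r) b (suc i) (suc j) (s<s i<j , r-i≡b , r-j≡b , between) =
    safeRun-valid r b i j (i<j , r-i≡b , r-j≡b , λ l i<l l<j → between (suc l) (s<s i<l) (s<s l<j))

  greedy : ∀ {m} R (s : BinEnds m) → SuffixBounded m R → Room R s → SafeRun R s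
  greedy []      s _       _    = done
  greedy (x ∷ R) s bounded room with b , sb≢c , relief ← choose-bin x R s bounded room =
    place b sb≢c (greedy R (put s b (color x)) (λ i → bounded (suc i))
                         (room-after-put x R s sb≢c room relief))

  zero-sizes-fit : ∀ {m} (L : List (Item k)) → All (λ x → size x ≡ 0ℚ) L →
                   (f : Packing L m) (b : Fin m) → load L f b ℚ.≤ 1ℚ
  zero-sizes-fit L zero-sizes f b =
    subst (ℚ._≤ 1ℚ) (sym (sum-zeros (map⁺ (tabulate⁺ contribution-zero)))) 0≤1
    where
    0≤1 : 0ℚ ℚ.≤ 1ℚ
    0≤1 = ℚ.*≤* (ℤ.+≤+ z≤n)
    sum-zeros : ∀ {qs} → All (_≡ 0ℚ) qs → foldr ℚ._+_ 0ℚ qs ≡ 0ℚ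
    sum-zeros []            = refl
    sum-zeros (refl ∷ rest) = trans (cong (0ℚ ℚ.+_) (sum-zeros rest)) (ℚ.+-identityʳ 0ℚ)
    contribution-zero : ∀ i → (if ⌊ f i ≟ b ⌋ then size (lookup L i) else 0ℚ) ≡ 0ℚ
    contribution-zero i with f i ≟ b
    ... | yes _ = All.lookup zero-sizes (∈-lookup i)
    ... | no _  = refl

theorem2p3 : (k : ℕ) (L : List (Item k)) →
    All (λ x → size x ≡ 0ℚ) L →
    Σ (Packing L (LB2 L)) (λ f → Valid L f)
theorem2p3 k L zero-sizes = bins run , λ b → zero-sizes-fit L zero-sizes (bins run) b , safeRun-valid run b
  where
  empty : BinEnds (LB2 L)
  empty = const nothing
  initial-room : Room L empty
  initial-room d = subst (λ n → n + excess d L ≤ LB2 L) (sym (ending-empty (LB2 L) d)) (excess≤LB2 L 0 d)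
  run : SafeRun L empty
  run = greedy L empty (excess≤LB2 L) initial-room
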